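{- Let $\mathcal{C}$ be a symmetric monoidal category and $u\leq v$ central idempotents. Then the category $\mathcal{C}|_u$ is (isomorphic to) the co-Kleisli category of the comonad $-\otimes U$ on $\mathcal{C}|_v$.
   Context: A central idempotent in a symmetric monoidal category $\mathcal{C}$ (unit $I$, unitors $\lambda,\rho$, symmetry $\sigma$) is a morphism $u\colon U\to I$ such that $\rho_U\circ(U\otimes u)=\lambda_U\circ(u\otimes U)\colon U\otimes U\to U$ and this morphism is invertible; $u\leq v$ means $u=v\circ m$ for some morphism $m\colon U\to V$. For a central idempotent $w$, $\mathcal{C}|_w$ is the symmetric monoidal category with the objects of $\mathcal{C}$, morphisms $A\to B$ being morphisms $A\otimes W\to B$ of $\mathcal{C}$, composition of $f\colon A\otimes W\to B$ and $g\colon B\otimes W\to C$ given by $g\circ(f\otimes W)\circ(A\otimes W\otimes w)^{ -1}$, identity $A\otimes w$, tensor of objects as in $\mathcal{C}$, and tensor of $f\colon A\otimes W\to B$, $f'\colon A'\otimes W\to B'$ given by $(f\otimes f')\circ(A\otimes\sigma_{A',W}\otimes W)\circ(A\otimes A'\otimes W\otimes w)^{ -1}$. For $u\leq v$, the endofunctor $-\otimes U$ on $\mathcal{C}|_v$ carries a comonad structure (counit induced by $u$, comultiplication induced by the inverse of $U\otimes u$). -}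

module Defs where

open import Level using (Level; _⊔_; suc)
open import Data.Product using (Σ; ∃; _×_; _,_)
open import Relation.Binary.PropositionalEquality using (_≡_)
open import Function.Definitions using (Bijective)

record SymMonCat (o ℓ : Level) : Set (suc (o ⊔ ℓ)) where
  infixr 9 _∘_
  infixr 10 _⊗₀_ _⊗₁_
  infix 4 _⇒_
  field
    Obj  : Set o
    _⇒_  : Obj → Obj → Set ℓ
    id   : ∀ {A} → A ⇒ A
    _∘_  : ∀ {A B C} → B ⇒ C → A ⇒ B → A ⇒ C
    assoc     : ∀ {A B C D} {f : A ⇒ B} {g : B ⇒ C} {h : C ⇒ D} →
                (h ∘ g) ∘ f ≡ h ∘ (g ∘ f)
    identityˡ : ∀ {A B} {f : A ⇒ B} → id ∘ f ≡ f
    identityʳ : ∀ {A B} {f : A ⇒ B} → f ∘ id ≡ f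

    _⊗₀_ : Obj → Obj → Obj
    _⊗₁_ : ∀ {A B C D} → A ⇒ B → C ⇒ D → (A ⊗₀ C) ⇒ (B ⊗₀ D)
    ⊗-id : ∀ {A B} → id {A} ⊗₁ id {B} ≡ id
    ⊗-∘  : ∀ {A B C A' B' C'} {f : A ⇒ B} {g : B ⇒ C} {f' : A' ⇒ B'} {g' : B' ⇒ C'} →
           (g ∘ f) ⊗₁ (g' ∘ f') ≡ (g ⊗₁ g') ∘ (f ⊗₁ f')

    I : Obj

    α⇒ : ∀ {A B C} → (A ⊗₀ B) ⊗₀ C ⇒ A ⊗₀ (B ⊗₀ C)
    α⇐ : ∀ {A B C} → A ⊗₀ (B ⊗₀ C) ⇒ (A ⊗₀ B) ⊗₀ C
    α-isoˡ : ∀ {A B C} → α⇐ {A} {B} {C} ∘ α⇒ ≡ id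
    α-isoʳ : ∀ {A B C} → α⇒ {A} {B} {C} ∘ α⇐ ≡ id
    α-nat  : ∀ {A B C A' B' C'} {f : A ⇒ A'} {g : B ⇒ B'} {h : C ⇒ C'} →
             α⇒ ∘ ((f ⊗₁ g) ⊗₁ h) ≡ (f ⊗₁ (g ⊗₁ h)) ∘ α⇒

    λ⇒ : ∀ {A} → I ⊗₀ A ⇒ A
    λ⇐ : ∀ {A} → A ⇒ I ⊗₀ A
    λ-isoˡ : ∀ {A} → λ⇐ {A} ∘ λ⇒ ≡ id
    λ-isoʳ : ∀ {A} → λ⇒ {A} ∘ λ⇐ ≡ id
    λ-nat  : ∀ {A B} {f : A ⇒ B} → λ⇒ ∘ (id ⊗₁ f) ≡ f ∘ λ⇒

    ρ⇒ : ∀ {A} → A ⊗₀ I ⇒ A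
    ρ⇐ : ∀ {A} → A ⇒ A ⊗₀ I
    ρ-isoˡ : ∀ {A} → ρ⇐ {A} ∘ ρ⇒ ≡ id
    ρ-isoʳ : ∀ {A} → ρ⇒ {A} ∘ ρ⇐ ≡ id
    ρ-nat  : ∀ {A B} {f : A ⇒ B} → ρ⇒ ∘ (f ⊗₁ id) ≡ f ∘ ρ⇒

    σ : ∀ {A B} → A ⊗₀ B ⇒ B ⊗₀ A
    σ-nat : ∀ {A B A' B'} {f : A ⇒ A'} {g : B ⇒ B'} →
            σ ∘ (f ⊗₁ g) ≡ (g ⊗₁ f) ∘ σ
    σ-inv : ∀ {A B} → σ {B} {A} ∘ σ {A} {B} ≡ id

    triangle : ∀ {A B} → (id {A} ⊗₁ λ⇒ {B}) ∘ α⇒ ≡ ρ⇒ ⊗₁ id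
    pentagon : ∀ {A B C D} →
               (id {A} ⊗₁ α⇒ {B} {C} {D}) ∘ α⇒ ∘ (α⇒ ⊗₁ id) ≡ α⇒ ∘ α⇒
    hexagon  : ∀ {A B C} →
               α⇒ {B} {C} {A} ∘ σ {A} {B ⊗₀ C} ∘ α⇒ ≡
               (id ⊗₁ σ) ∘ α⇒ ∘ (σ ⊗₁ id)

record RawCategory (o ℓ : Level) : Set (suc (o ⊔ ℓ)) where
  field
    Obj : Set o
    Hom : Obj → Obj → Set ℓ
    id  : ∀ {A} → Hom A A
    _∘_ : ∀ {A B C} → Hom B C → Hom A B → Hom A C

record CatIso {o ℓ o' ℓ'} (C : RawCategory o ℓ) (D : RawCategory o' ℓ')
              : Set (o ⊔ ℓ ⊔ o' ⊔ ℓ') where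
  private
    module C = RawCategory C
    module D = RawCategory D
  field
    F₀ : C.Obj → D.Obj
    F₁ : ∀ {A B} → C.Hom A B → D.Hom (F₀ A) (F₀ B)
    F-id : ∀ {A} → F₁ (C.id {A}) ≡ D.id
    F-∘  : ∀ {A B C'} {f : C.Hom A B} {g : C.Hom B C'} →
           F₁ (g C.∘ f) ≡ F₁ g D.∘ F₁ f
    F₀-bij : Bijective _≡_ _≡_ F₀
    F₁-bij : ∀ {A B} → Bijective _≡_ _≡_ (F₁ {A} {B})

record RawComonad {o ℓ} (D : RawCategory o ℓ) : Set (o ⊔ ℓ) where
  open RawCategory D
  field
    T₀ : Obj → Obj
    T₁ : ∀ {A B} → Hom A B → Hom (T₀ A) (T₀ B)
    ε  : ∀ {A} → Hom (T₀ A) A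
    δ  : ∀ {A} → Hom (T₀ A) (T₀ (T₀ A))

coKleisli : ∀ {o ℓ} {D : RawCategory o ℓ} → RawComonad D → RawCategory o ℓ
coKleisli {D = D} M = record
  { Obj = Obj
  ; Hom = λ A B → Hom (T₀ A) B
  ; id  = ε
  ; _∘_ = λ g f → g ∘ (T₁ f ∘ δ)
  }
  where open RawCategory D
        open RawComonad M

module _ {o ℓ} (C : SymMonCat o ℓ) where
  open SymMonCat C

  record CentralIdem : Set (o ⊔ ℓ) where
    field
      U : Obj
      u : U ⇒ I
      central : ρ⇒ ∘ (id ⊗₁ u) ≡ λ⇒ ∘ (u ⊗₁ id)
      inv : U ⇒ U ⊗₀ U
      inv-isoˡ : inv ∘ (ρ⇒ ∘ (id ⊗₁ u)) ≡ id
      inv-isoʳ : (ρ⇒ ∘ (id ⊗₁ u)) ∘ inv ≡ id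

  _≤ᶜ_ : CentralIdem → CentralIdem → Set ℓ
  x ≤ᶜ y = Σ (CentralIdem.U x ⇒ CentralIdem.U y)
             (λ m → CentralIdem.u x ≡ CentralIdem.u y ∘ m)

  module Restrict (w : CentralIdem) where
    open CentralIdem w renaming (U to W; u to wm)

    Homʷ : Obj → Obj → Set ℓ
    Homʷ A B = A ⊗₀ W ⇒ B

    idʷ : ∀ {A} → Homʷ A A
    idʷ = ρ⇒ ∘ (id ⊗₁ wm)

    _∘ʷ_ : ∀ {A B D} → Homʷ B D → Homʷ A B → Homʷ A D
    g ∘ʷ f = g ∘ ((f ⊗₁ id) ∘ (α⇐ ∘ (id ⊗₁ inv)))

    shuffle : ∀ {A A'} → (A ⊗₀ A') ⊗₀ (W ⊗₀ W) ⇒ (A ⊗₀ W) ⊗₀ (A' ⊗₀ W)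
    shuffle = α⇐ ∘ ((id ⊗₁ α⇒) ∘ ((id ⊗₁ (σ ⊗₁ id)) ∘ ((id ⊗₁ α⇐) ∘ α⇒)))

    _⊗ʷ_ : ∀ {A B A' B'} → Homʷ A B → Homʷ A' B' → Homʷ (A ⊗₀ A') (B ⊗₀ B')
    f ⊗ʷ f' = (f ⊗₁ f') ∘ (shuffle ∘ (id ⊗₁ inv))

    embʷ : ∀ {A B} → A ⇒ B → Homʷ A B
    embʷ g = g ∘ (ρ⇒ ∘ (id ⊗₁ wm))

  restrict : CentralIdem → RawCategory o ℓ
  restrict w = record
    { Obj = Obj
    ; Hom = Homʷ
    ; id  = idʷ
    ; _∘_ = _∘ʷ_
    }
    where open Restrict w

  tensorComonad : (x y : CentralIdem) → RawComonad (restrict y)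
  tensorComonad x y = record
    { T₀ = λ A → A ⊗₀ U
    ; T₁ = λ f → f ⊗ʷ idʷ
    ; ε  = embʷ (ρ⇒ ∘ (id ⊗₁ u))
    ; δ  = embʷ (α⇐ ∘ (id ⊗₁ inv))
    }
    where open CentralIdem x
          open Restrict y

-- Precomposition with discardᵛ = ρ ∘ (A ⊗ v) : A ⊗ V → A turns a morphism A ⊗ U → B of C|_u
-- into a co-Kleisli morphism (A ⊗ U) ⊗ V → B. This is the action on morphisms of the canonical
-- functor C → C|_v, f ↦ f ∘ discardᵛ, which is strict monoidal; that alone makes the assignment
-- functorial, for any u and v. If u = v ∘ m, then (U ⊗ m) ∘ (ρ ∘ (U ⊗ u))⁻¹ inverts
-- ρ ∘ (U ⊗ v) : U ⊗ V → U, so discardᵛ is invertible on every A ⊗ U and precomposition with it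
-- is bijective on hom-sets.
module Submission where

open import Data.Product using (_,_; proj₁; proj₂)
open import Relation.Binary.PropositionalEquality
open import Function.Definitions using (Bijective)
open import Function.Construct.Identity using (bijective)
open import Defs

module MonoidalProperties {o ℓ} (C : SymMonCat o ℓ) where
  open SymMonCat C
  open ≡-Reasoning

  record IsIso {A B} (f : A ⇒ B) : Set ℓ where
    field
      inverse : B ⇒ A
      isoˡ    : inverse ∘ f ≡ id
      isoʳ    : f ∘ inverse ≡ id

  pullˡ : ∀ {A B D E} {f : D ⇒ E} {g : B ⇒ D} {h : B ⇒ E} {k : A ⇒ B} →
          f ∘ g ≡ h → f ∘ (g ∘ k) ≡ h ∘ k
  pullˡ {k = k} eq = trans (sym assoc) (cong (_∘ k) eq)

  pullʳ : ∀ {A B D E} {f : D ⇒ E} {g : B ⇒ D} {h : A ⇒ D} {k : A ⇒ B} →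
          g ∘ k ≡ h → (f ∘ g) ∘ k ≡ f ∘ h
  pullʳ {f = f} eq = trans assoc (cong (f ∘_) eq)

  ∘-cancelʳ : ∀ {A B D} {f : B ⇒ D} {e : A ⇒ B} {e⁻ : B ⇒ A} →
              e ∘ e⁻ ≡ id → (f ∘ e) ∘ e⁻ ≡ f
  ∘-cancelʳ {f = f} e∘e⁻ = trans assoc (trans (cong (f ∘_) e∘e⁻) identityʳ)

  ∘-cancelˡ : ∀ {A B D} {f : A ⇒ B} {e : B ⇒ D} {e⁻ : D ⇒ B} →
              e⁻ ∘ e ≡ id → e⁻ ∘ (e ∘ f) ≡ f
  ∘-cancelˡ {f = f} e⁻∘e = trans (sym assoc) (trans (cong (_∘ f) e⁻∘e) identityˡ)

  switch-∘ʳ : ∀ {A B D} {f : B ⇒ D} {g : A ⇒ D} {e : A ⇒ B} {e⁻ : B ⇒ A} →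
              e ∘ e⁻ ≡ id → f ∘ e ≡ g → f ≡ g ∘ e⁻
  switch-∘ʳ e∘e⁻ eq = trans (sym (∘-cancelʳ e∘e⁻)) (cong (_∘ _) eq)

  split-epi-cancel : ∀ {A B D} {f g : B ⇒ D} {e : A ⇒ B} {e⁻ : B ⇒ A} →
                     e ∘ e⁻ ≡ id → f ∘ e ≡ g ∘ e → f ≡ g
  split-epi-cancel e∘e⁻ eq = trans (switch-∘ʳ e∘e⁻ eq) (∘-cancelʳ e∘e⁻)

  split-mono-cancel : ∀ {A B D} {f g : A ⇒ B} {e : B ⇒ D} {e⁻ : D ⇒ B} →
                      e⁻ ∘ e ≡ id → e ∘ f ≡ e ∘ g → f ≡ g
  split-mono-cancel e⁻∘e eq =
    trans (sym (∘-cancelˡ e⁻∘e)) (trans (cong (_ ∘_) eq) (∘-cancelˡ e⁻∘e))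

  ∘-inverse : ∀ {A B D} {e₁ : B ⇒ D} {e₁⁻ : D ⇒ B} {e₂ : A ⇒ B} {e₂⁻ : B ⇒ A} →
              e₁ ∘ e₁⁻ ≡ id → e₂ ∘ e₂⁻ ≡ id → (e₁ ∘ e₂) ∘ (e₂⁻ ∘ e₁⁻) ≡ id
  ∘-inverse e₁∘e₁⁻ e₂∘e₂⁻ = trans (sym assoc) (trans (cong (_∘ _) (∘-cancelʳ e₂∘e₂⁻)) e₁∘e₁⁻)

  ∘-bijectiveʳ : ∀ {A B D} {e : A ⇒ B} → IsIso e → Bijective _≡_ _≡_ (λ (f : B ⇒ D) → f ∘ e)
  ∘-bijectiveʳ e-iso =
    split-epi-cancel isoʳ ,
    λ g → g ∘ inverse , λ f≡ → trans (cong (_∘ _) f≡) (∘-cancelʳ isoˡ)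
    where open IsIso e-iso

  serialize₁₂ : ∀ {A B P Q} {f : A ⇒ B} {g : P ⇒ Q} → f ⊗₁ g ≡ (f ⊗₁ id) ∘ (id ⊗₁ g)
  serialize₁₂ = trans (sym (cong₂ _⊗₁_ identityʳ identityˡ)) ⊗-∘

  serialize₂₁ : ∀ {A B P Q} {f : A ⇒ B} {g : P ⇒ Q} → f ⊗₁ g ≡ (id ⊗₁ g) ∘ (f ⊗₁ id)
  serialize₂₁ = trans (sym (cong₂ _⊗₁_ identityˡ identityʳ)) ⊗-∘

  id⊗-∘ : ∀ {X A B D} {f : B ⇒ D} {g : A ⇒ B} → id {X} ⊗₁ (f ∘ g) ≡ (id ⊗₁ f) ∘ (id ⊗₁ g)
  id⊗-∘ = trans (cong (_⊗₁ _) (sym identityˡ)) ⊗-∘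

  ⊗id-∘ : ∀ {X A B D} {f : B ⇒ D} {g : A ⇒ B} → (f ∘ g) ⊗₁ id {X} ≡ (f ⊗₁ id) ∘ (g ⊗₁ id)
  ⊗id-∘ = trans (cong (_ ⊗₁_) (sym identityˡ)) ⊗-∘

  pull-id⊗ : ∀ {X A B D E} {f : B ⇒ D} {g : A ⇒ B} {k : E ⇒ X ⊗₀ A} →
             (id ⊗₁ f) ∘ ((id ⊗₁ g) ∘ k) ≡ (id ⊗₁ (f ∘ g)) ∘ k
  pull-id⊗ = trans (sym assoc) (cong (_∘ _) (sym id⊗-∘))

  ⊗id-inverse : ∀ {X A B} {e : A ⇒ B} {e⁻ : B ⇒ A} → e ∘ e⁻ ≡ id → (e ⊗₁ id {X}) ∘ (e⁻ ⊗₁ id) ≡ id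
  ⊗id-inverse e∘e⁻ = trans (sym ⊗id-∘) (trans (cong (_⊗₁ id) e∘e⁻) ⊗-id)

  ⊗I-injective : ∀ {A B} {f g : A ⇒ B} → f ⊗₁ id {I} ≡ g ⊗₁ id → f ≡ g
  ⊗I-injective {f = f} {g} eq = begin
    f                     ≡⟨ switch-∘ʳ ρ-isoʳ (sym ρ-nat) ⟩
    (ρ⇒ ∘ (f ⊗₁ id)) ∘ ρ⇐ ≡⟨ cong (λ k → (ρ⇒ ∘ k) ∘ ρ⇐) eq ⟩
    (ρ⇒ ∘ (g ⊗₁ id)) ∘ ρ⇐ ≡⟨ sym (switch-∘ʳ ρ-isoʳ (sym ρ-nat)) ⟩
    g                     ∎

  I⊗-injective : ∀ {A B} {f g : A ⇒ B} → id {I} ⊗₁ f ≡ id ⊗₁ g → f ≡ g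
  I⊗-injective {f = f} {g} eq = begin
    f                     ≡⟨ switch-∘ʳ λ-isoʳ (sym λ-nat) ⟩
    (λ⇒ ∘ (id ⊗₁ f)) ∘ λ⇐ ≡⟨ cong (λ k → (λ⇒ ∘ k) ∘ λ⇐) eq ⟩
    (λ⇒ ∘ (id ⊗₁ g)) ∘ λ⇐ ≡⟨ sym (switch-∘ʳ λ-isoʳ (sym λ-nat)) ⟩
    g                     ∎

  α⇐-nat : ∀ {A B D A' B' D'} {f : A ⇒ A'} {g : B ⇒ B'} {h : D ⇒ D'} →
           α⇐ ∘ (f ⊗₁ (g ⊗₁ h)) ≡ ((f ⊗₁ g) ⊗₁ h) ∘ α⇐
  α⇐-nat {f = f} {g} {h} = begin
    α⇐ ∘ (f ⊗₁ (g ⊗₁ h))                ≡⟨ cong (α⇐ ∘_) (switch-∘ʳ α-isoʳ (sym α-nat)) ⟩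
    α⇐ ∘ ((α⇒ ∘ ((f ⊗₁ g) ⊗₁ h)) ∘ α⇐) ≡⟨ cong (α⇐ ∘_) assoc ⟩
    α⇐ ∘ (α⇒ ∘ (((f ⊗₁ g) ⊗₁ h) ∘ α⇐)) ≡⟨ ∘-cancelˡ α-isoˡ ⟩
    ((f ⊗₁ g) ⊗₁ h) ∘ α⇐                ∎

  kelly-ρ : ∀ {X Y} → (id {X} ⊗₁ ρ⇒ {Y}) ∘ α⇒ ≡ ρ⇒ {X ⊗₀ Y}
  kelly-ρ {X} {Y} = ⊗I-injective (split-mono-cancel α-isoˡ (sym chain))
    where
    chain : α⇒ ∘ (ρ⇒ {X ⊗₀ Y} ⊗₁ id {I}) ≡ α⇒ ∘ (((id ⊗₁ ρ⇒) ∘ α⇒) ⊗₁ id)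
    chain = begin
      α⇒ ∘ (ρ⇒ ⊗₁ id)                                       ≡⟨ cong (α⇒ ∘_) (sym triangle) ⟩
      α⇒ ∘ ((id ⊗₁ λ⇒) ∘ α⇒)                                ≡⟨ cong (λ k → α⇒ ∘ ((k ⊗₁ λ⇒) ∘ α⇒)) (sym ⊗-id) ⟩
      α⇒ ∘ (((id ⊗₁ id) ⊗₁ λ⇒) ∘ α⇒)                        ≡⟨ pullˡ α-nat ⟩
      ((id ⊗₁ (id ⊗₁ λ⇒)) ∘ α⇒) ∘ α⇒                        ≡⟨ assoc ⟩
      (id ⊗₁ (id ⊗₁ λ⇒)) ∘ (α⇒ ∘ α⇒)                        ≡⟨ cong ((id ⊗₁ (id ⊗₁ λ⇒)) ∘_) (sym pentagon) ⟩
      (id ⊗₁ (id ⊗₁ λ⇒)) ∘ ((id ⊗₁ α⇒) ∘ (α⇒ ∘ (α⇒ ⊗₁ id))) ≡⟨ pull-id⊗ ⟩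
      (id ⊗₁ ((id ⊗₁ λ⇒) ∘ α⇒)) ∘ (α⇒ ∘ (α⇒ ⊗₁ id))         ≡⟨ cong (λ k → (id ⊗₁ k) ∘ (α⇒ ∘ (α⇒ ⊗₁ id))) triangle ⟩
      (id ⊗₁ (ρ⇒ ⊗₁ id)) ∘ (α⇒ ∘ (α⇒ ⊗₁ id))                ≡⟨ pullˡ (sym α-nat) ⟩
      (α⇒ ∘ ((id ⊗₁ ρ⇒) ⊗₁ id)) ∘ (α⇒ ⊗₁ id)                ≡⟨ pullʳ (sym ⊗id-∘) ⟩
      α⇒ ∘ (((id ⊗₁ ρ⇒) ∘ α⇒) ⊗₁ id)                        ∎

  kelly-λ : ∀ {X Y} → λ⇒ {X ⊗₀ Y} ∘ α⇒ ≡ λ⇒ ⊗₁ id {Y}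
  kelly-λ {X} {Y} = I⊗-injective (split-epi-cancel α²-inverse (trans lhs (sym rhs)))
    where
    α²-inverse : (α⇒ {I} {I ⊗₀ X} {Y} ∘ (α⇒ ⊗₁ id)) ∘ ((α⇐ ⊗₁ id) ∘ α⇐) ≡ id
    α²-inverse = ∘-inverse α-isoʳ (⊗id-inverse α-isoʳ)
    lhs : (id {I} ⊗₁ (λ⇒ {X ⊗₀ Y} ∘ α⇒)) ∘ (α⇒ ∘ (α⇒ ⊗₁ id)) ≡ α⇒ ∘ ((ρ⇒ ⊗₁ id) ⊗₁ id)
    lhs = begin
      (id ⊗₁ (λ⇒ ∘ α⇒)) ∘ (α⇒ ∘ (α⇒ ⊗₁ id))         ≡⟨ cong (_∘ (α⇒ ∘ (α⇒ ⊗₁ id))) id⊗-∘ ⟩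
      ((id ⊗₁ λ⇒) ∘ (id ⊗₁ α⇒)) ∘ (α⇒ ∘ (α⇒ ⊗₁ id)) ≡⟨ pullʳ pentagon ⟩
      (id ⊗₁ λ⇒) ∘ (α⇒ ∘ α⇒)                         ≡⟨ pullˡ triangle ⟩
      (ρ⇒ ⊗₁ id) ∘ α⇒                                ≡⟨ cong (λ k → (ρ⇒ ⊗₁ k) ∘ α⇒) (sym ⊗-id) ⟩
      (ρ⇒ ⊗₁ (id ⊗₁ id)) ∘ α⇒                        ≡⟨ sym α-nat ⟩
      α⇒ ∘ ((ρ⇒ ⊗₁ id) ⊗₁ id)                        ∎
    rhs : (id {I} ⊗₁ (λ⇒ {X} ⊗₁ id {Y})) ∘ (α⇒ ∘ (α⇒ ⊗₁ id)) ≡ α⇒ ∘ ((ρ⇒ ⊗₁ id) ⊗₁ id)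
    rhs = begin
      (id ⊗₁ (λ⇒ ⊗₁ id)) ∘ (α⇒ ∘ (α⇒ ⊗₁ id)) ≡⟨ pullˡ (sym α-nat) ⟩
      (α⇒ ∘ ((id ⊗₁ λ⇒) ⊗₁ id)) ∘ (α⇒ ⊗₁ id) ≡⟨ pullʳ (sym ⊗id-∘) ⟩
      α⇒ ∘ (((id ⊗₁ λ⇒) ∘ α⇒) ⊗₁ id)         ≡⟨ cong (λ k → α⇒ ∘ (k ⊗₁ id)) triangle ⟩
      α⇒ ∘ ((ρ⇒ ⊗₁ id) ⊗₁ id)                ∎

  λ∘σ≡ρ : ∀ {A} → λ⇒ {A} ∘ σ {A} {I} ≡ ρ⇒
  λ∘σ≡ρ = ⊗I-injective (split-mono-cancel {e = σ} σ-inv (begin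
    σ ∘ ((λ⇒ ∘ σ) ⊗₁ id)                ≡⟨ cong (σ ∘_) ⊗id-∘ ⟩
    σ ∘ ((λ⇒ ⊗₁ id) ∘ (σ ⊗₁ id))        ≡⟨ cong (λ k → σ ∘ (k ∘ (σ ⊗₁ id))) (sym kelly-λ) ⟩
    σ ∘ ((λ⇒ ∘ α⇒) ∘ (σ ⊗₁ id))         ≡⟨ cong (σ ∘_) assoc ⟩
    σ ∘ (λ⇒ ∘ (α⇒ ∘ (σ ⊗₁ id)))         ≡⟨ pullˡ (sym λ-nat) ⟩
    (λ⇒ ∘ (id ⊗₁ σ)) ∘ (α⇒ ∘ (σ ⊗₁ id)) ≡⟨ pullʳ (sym hexagon) ⟩
    λ⇒ ∘ (α⇒ ∘ (σ ∘ α⇒))                ≡⟨ pullˡ kelly-λ ⟩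
    (λ⇒ ⊗₁ id) ∘ (σ ∘ α⇒)               ≡⟨ pullˡ (sym σ-nat) ⟩
    (σ ∘ (id ⊗₁ λ⇒)) ∘ α⇒               ≡⟨ pullʳ triangle ⟩
    σ ∘ (ρ⇒ ⊗₁ id)                      ∎))

  exchange₁₂ : ∀ {A B D} → A ⊗₀ (B ⊗₀ D) ⇒ B ⊗₀ (A ⊗₀ D)
  exchange₁₂ = α⇒ ∘ ((σ ⊗₁ id) ∘ α⇐)

  module Discard {W} (h : W ⇒ I) where

    discard : ∀ {X} → X ⊗₀ W ⇒ X
    discard = ρ⇒ ∘ (id ⊗₁ h)

    discardˡ : ∀ {X} → W ⊗₀ X ⇒ X
    discardˡ = λ⇒ ∘ (h ⊗₁ id)

    discard-natural : ∀ {A B} {k : A ⇒ B} → discard ∘ (k ⊗₁ id) ≡ k ∘ discard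
    discard-natural {k = k} = begin
      (ρ⇒ ∘ (id ⊗₁ h)) ∘ (k ⊗₁ id) ≡⟨ pullʳ (trans (sym serialize₂₁) serialize₁₂) ⟩
      ρ⇒ ∘ ((k ⊗₁ id) ∘ (id ⊗₁ h)) ≡⟨ pullˡ ρ-nat ⟩
      (k ∘ ρ⇒) ∘ (id ⊗₁ h)         ≡⟨ assoc ⟩
      k ∘ (ρ⇒ ∘ (id ⊗₁ h))         ∎

    discard-α⇒ : ∀ {X Y} → (id {X} ⊗₁ discard {Y}) ∘ α⇒ ≡ discard
    discard-α⇒ = begin
      (id ⊗₁ (ρ⇒ ∘ (id ⊗₁ h))) ∘ α⇒          ≡⟨ cong (_∘ α⇒) id⊗-∘ ⟩
      ((id ⊗₁ ρ⇒) ∘ (id ⊗₁ (id ⊗₁ h))) ∘ α⇒  ≡⟨ pullʳ (sym α-nat) ⟩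
      (id ⊗₁ ρ⇒) ∘ (α⇒ ∘ ((id ⊗₁ id) ⊗₁ h))  ≡⟨ pullˡ kelly-ρ ⟩
      ρ⇒ ∘ ((id ⊗₁ id) ⊗₁ h)                 ≡⟨ cong (λ k → ρ⇒ ∘ (k ⊗₁ h)) ⊗-id ⟩
      ρ⇒ ∘ (id ⊗₁ h)                         ∎

    discard-α⇐ : ∀ {X Y} → discard ∘ α⇐ ≡ id {X} ⊗₁ discard {Y}
    discard-α⇐ = sym (switch-∘ʳ α-isoʳ discard-α⇒)

    discardˡ-α⇒ : ∀ {X Y} → (id {X} ⊗₁ discardˡ {Y}) ∘ α⇒ ≡ discard ⊗₁ id
    discardˡ-α⇒ = begin
      (id ⊗₁ (λ⇒ ∘ (h ⊗₁ id))) ∘ α⇒         ≡⟨ cong (_∘ α⇒) id⊗-∘ ⟩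
      ((id ⊗₁ λ⇒) ∘ (id ⊗₁ (h ⊗₁ id))) ∘ α⇒ ≡⟨ pullʳ (sym α-nat) ⟩
      (id ⊗₁ λ⇒) ∘ (α⇒ ∘ ((id ⊗₁ h) ⊗₁ id)) ≡⟨ pullˡ triangle ⟩
      (ρ⇒ ⊗₁ id) ∘ ((id ⊗₁ h) ⊗₁ id)        ≡⟨ sym ⊗id-∘ ⟩
      (ρ⇒ ∘ (id ⊗₁ h)) ⊗₁ id                ∎

    discard⊗id-α⇐ : ∀ {X Y} → (discard {X} ⊗₁ id {Y}) ∘ α⇐ ≡ id ⊗₁ discardˡ
    discard⊗id-α⇐ = sym (switch-∘ʳ α-isoʳ discardˡ-α⇒)

    discardˡ∘σ : ∀ {X} → discardˡ ∘ σ ≡ discard {X}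
    discardˡ∘σ = begin
      (λ⇒ ∘ (h ⊗₁ id)) ∘ σ ≡⟨ pullʳ (sym σ-nat) ⟩
      λ⇒ ∘ (σ ∘ (id ⊗₁ h)) ≡⟨ pullˡ λ∘σ≡ρ ⟩
      ρ⇒ ∘ (id ⊗₁ h)       ∎

    discard-iso-⊗ : ∀ {A U} → IsIso (discard {U}) → IsIso (discard {A ⊗₀ U})
    discard-iso-⊗ U-iso = record
      { inverse = α⇐ ∘ (id ⊗₁ inverse)
      ; isoˡ = begin
          (α⇐ ∘ (id ⊗₁ inverse)) ∘ discard                ≡⟨ cong ((α⇐ ∘ (id ⊗₁ inverse)) ∘_) (sym discard-α⇒) ⟩
          (α⇐ ∘ (id ⊗₁ inverse)) ∘ ((id ⊗₁ discard) ∘ α⇒) ≡⟨ pullʳ pull-id⊗ ⟩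
          α⇐ ∘ ((id ⊗₁ (inverse ∘ discard)) ∘ α⇒)         ≡⟨ cong (λ k → α⇐ ∘ ((id ⊗₁ k) ∘ α⇒)) isoˡ ⟩
          α⇐ ∘ ((id ⊗₁ id) ∘ α⇒)                          ≡⟨ cong (λ k → α⇐ ∘ (k ∘ α⇒)) ⊗-id ⟩
          α⇐ ∘ (id ∘ α⇒)                                  ≡⟨ cong (α⇐ ∘_) identityˡ ⟩
          α⇐ ∘ α⇒                                         ≡⟨ α-isoˡ ⟩
          id                                              ∎
      ; isoʳ = begin
          discard ∘ (α⇐ ∘ (id ⊗₁ inverse))   ≡⟨ pullˡ discard-α⇐ ⟩
          (id ⊗₁ discard) ∘ (id ⊗₁ inverse)  ≡⟨ sym id⊗-∘ ⟩
          id ⊗₁ (discard ∘ inverse)          ≡⟨ cong (id ⊗₁_) isoʳ ⟩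
          id ⊗₁ id                           ≡⟨ ⊗-id ⟩
          id                                 ∎
      }
      where open IsIso U-iso

    discard⊗discard-α⇐ : ∀ {X Y} → (discard {X} ⊗₁ discard {Y}) ∘ α⇐ ≡ id ⊗₁ (discardˡ ∘ (id ⊗₁ discard))
    discard⊗discard-α⇐ = begin
      (discard ⊗₁ discard) ∘ α⇐                      ≡⟨ cong (_∘ α⇐) serialize₁₂ ⟩
      ((discard ⊗₁ id) ∘ (id ⊗₁ discard)) ∘ α⇐       ≡⟨ cong (λ k → ((discard ⊗₁ id) ∘ (k ⊗₁ discard)) ∘ α⇐) (sym ⊗-id) ⟩
      ((discard ⊗₁ id) ∘ ((id ⊗₁ id) ⊗₁ discard)) ∘ α⇐ ≡⟨ pullʳ (sym α⇐-nat) ⟩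
      (discard ⊗₁ id) ∘ (α⇐ ∘ (id ⊗₁ (id ⊗₁ discard))) ≡⟨ pullˡ discard⊗id-α⇐ ⟩
      (id ⊗₁ discardˡ) ∘ (id ⊗₁ (id ⊗₁ discard))     ≡⟨ sym id⊗-∘ ⟩
      id ⊗₁ (discardˡ ∘ (id ⊗₁ discard))             ∎

    discardˡ∘id⊗discard∘exchange₁₂ : ∀ {Y} →
      (discardˡ ∘ (id ⊗₁ discard)) ∘ exchange₁₂ ≡ discard {Y} ∘ (id ⊗₁ discard)
    discardˡ∘id⊗discard∘exchange₁₂ = begin
      (discardˡ ∘ (id ⊗₁ discard)) ∘ exchange₁₂ ≡⟨ assoc ⟩
      discardˡ ∘ ((id ⊗₁ discard) ∘ exchange₁₂) ≡⟨ cong (discardˡ ∘_) (pullˡ discard-α⇒) ⟩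
      discardˡ ∘ (discard ∘ ((σ ⊗₁ id) ∘ α⇐))                ≡⟨ cong (discardˡ ∘_) (pullˡ discard-natural) ⟩
      discardˡ ∘ ((σ ∘ discard) ∘ α⇐)                        ≡⟨ cong (discardˡ ∘_) assoc ⟩
      discardˡ ∘ (σ ∘ (discard ∘ α⇐))                        ≡⟨ pullˡ discardˡ∘σ ⟩
      discard ∘ (discard ∘ α⇐)                               ≡⟨ cong (discard ∘_) discard-α⇐ ⟩
      discard ∘ (id ⊗₁ discard)                              ∎

module Restriction {o ℓ} (C : SymMonCat o ℓ) (w : CentralIdem C) where
  open SymMonCat C
  open MonoidalProperties C
  open CentralIdem w renaming (U to W; u to wm)
  open Restrict C w
  open Discard wm
  open ≡-Reasoning

  copy : ∀ {A} → A ⊗₀ W ⇒ (A ⊗₀ W) ⊗₀ W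
  copy = α⇐ ∘ (id ⊗₁ inv)

  discard⊗id∘copy : ∀ {A} → (discard {A} ⊗₁ id) ∘ copy ≡ id
  discard⊗id∘copy = begin
    (discard ⊗₁ id) ∘ copy               ≡⟨ pullˡ discard⊗id-α⇐ ⟩
    (id ⊗₁ discardˡ) ∘ (id ⊗₁ inv)       ≡⟨ sym id⊗-∘ ⟩
    id ⊗₁ (discardˡ ∘ inv)               ≡⟨ cong (λ k → id ⊗₁ (k ∘ inv)) (sym central) ⟩
    id ⊗₁ (discard ∘ inv)                ≡⟨ cong (id ⊗₁_) inv-isoʳ ⟩
    id ⊗₁ id                             ≡⟨ ⊗-id ⟩
    id                                   ∎

  embʷ-∘ʷ : ∀ {A B D} {g : B ⇒ D} {f : A ⇒ B} → embʷ g ∘ʷ embʷ f ≡ embʷ (g ∘ f)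
  embʷ-∘ʷ {g = g} {f} = begin
    (g ∘ discard) ∘ (((f ∘ discard) ⊗₁ id) ∘ copy)        ≡⟨ cong (λ k → (g ∘ discard) ∘ (k ∘ copy)) ⊗id-∘ ⟩
    (g ∘ discard) ∘ (((f ⊗₁ id) ∘ (discard ⊗₁ id)) ∘ copy) ≡⟨ cong ((g ∘ discard) ∘_) (pullʳ discard⊗id∘copy) ⟩
    (g ∘ discard) ∘ ((f ⊗₁ id) ∘ id)                       ≡⟨ cong ((g ∘ discard) ∘_) identityʳ ⟩
    (g ∘ discard) ∘ (f ⊗₁ id)                              ≡⟨ pullʳ discard-natural ⟩
    g ∘ (f ∘ discard)                                      ≡⟨ sym assoc ⟩
    (g ∘ f) ∘ discard                                      ∎

  shuffle-factor : ∀ {X Y} → shuffle {X} {Y} ≡ α⇐ ∘ ((id ⊗₁ exchange₁₂) ∘ α⇒)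
  shuffle-factor = cong (α⇐ ∘_) (trans (cong (_ ∘_) pull-id⊗) pull-id⊗)

  discard⊗discard∘shuffle : ∀ {X Y} → (discard {X} ⊗₁ discard {Y}) ∘ shuffle ≡ discard ∘ (id ⊗₁ discard)
  discard⊗discard∘shuffle = begin
    (discard ⊗₁ discard) ∘ shuffle
      ≡⟨ cong ((discard ⊗₁ discard) ∘_) shuffle-factor ⟩
    (discard ⊗₁ discard) ∘ (α⇐ ∘ ((id ⊗₁ exchange₁₂) ∘ α⇒))
      ≡⟨ pullˡ discard⊗discard-α⇐ ⟩
    (id ⊗₁ (discardˡ ∘ (id ⊗₁ discard))) ∘ ((id ⊗₁ exchange₁₂) ∘ α⇒)
      ≡⟨ pull-id⊗ ⟩
    (id ⊗₁ ((discardˡ ∘ (id ⊗₁ discard)) ∘ exchange₁₂)) ∘ α⇒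
      ≡⟨ cong (λ k → (id ⊗₁ k) ∘ α⇒) discardˡ∘id⊗discard∘exchange₁₂ ⟩
    (id ⊗₁ (discard ∘ (id ⊗₁ discard))) ∘ α⇒
      ≡⟨ cong (_∘ α⇒) id⊗-∘ ⟩
    ((id ⊗₁ discard) ∘ (id ⊗₁ (id ⊗₁ discard))) ∘ α⇒
      ≡⟨ pullʳ (sym α-nat) ⟩
    (id ⊗₁ discard) ∘ (α⇒ ∘ ((id ⊗₁ id) ⊗₁ discard))
      ≡⟨ pullˡ discard-α⇒ ⟩
    discard ∘ ((id ⊗₁ id) ⊗₁ discard)
      ≡⟨ cong (λ k → discard ∘ (k ⊗₁ discard)) ⊗-id ⟩
    discard ∘ (id ⊗₁ discard)
      ∎

  idʷ⊗ʷidʷ : ∀ {A B} → idʷ {A} ⊗ʷ idʷ {B} ≡ idʷ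
  idʷ⊗ʷidʷ = begin
    (discard ⊗₁ discard) ∘ (shuffle ∘ (id ⊗₁ inv)) ≡⟨ pullˡ discard⊗discard∘shuffle ⟩
    (discard ∘ (id ⊗₁ discard)) ∘ (id ⊗₁ inv)      ≡⟨ pullʳ (sym id⊗-∘) ⟩
    discard ∘ (id ⊗₁ (discard ∘ inv))              ≡⟨ cong (λ k → discard ∘ (id ⊗₁ k)) inv-isoʳ ⟩
    discard ∘ (id ⊗₁ id)                           ≡⟨ cong (discard ∘_) ⊗-id ⟩
    discard ∘ id                                   ≡⟨ identityʳ ⟩
    discard                                        ∎

  embʷ-⊗ʷ : ∀ {A B A' B'} {f : A ⇒ B} {g : A' ⇒ B'} → embʷ f ⊗ʷ embʷ g ≡ embʷ (f ⊗₁ g)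
  embʷ-⊗ʷ = trans (cong (_∘ (shuffle ∘ (id ⊗₁ inv))) ⊗-∘) (pullʳ idʷ⊗ʷidʷ)

  embʷ-coKleisli-∘ : ∀ {U A B D} {g : B ⊗₀ U ⇒ D} {f : A ⊗₀ U ⇒ B} {d : A ⊗₀ U ⇒ (A ⊗₀ U) ⊗₀ U} →
                     embʷ (g ∘ ((f ⊗₁ id) ∘ d)) ≡ embʷ g ∘ʷ ((embʷ f ⊗ʷ idʷ) ∘ʷ embʷ d)
  embʷ-coKleisli-∘ {g = g} {f} {d} = sym (begin
    embʷ g ∘ʷ ((embʷ f ⊗ʷ idʷ) ∘ʷ embʷ d)    ≡⟨ cong (λ k → embʷ g ∘ʷ ((embʷ f ⊗ʷ k) ∘ʷ embʷ d)) (sym identityˡ) ⟩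
    embʷ g ∘ʷ ((embʷ f ⊗ʷ embʷ id) ∘ʷ embʷ d) ≡⟨ cong (λ k → embʷ g ∘ʷ (k ∘ʷ embʷ d)) embʷ-⊗ʷ ⟩
    embʷ g ∘ʷ (embʷ (f ⊗₁ id) ∘ʷ embʷ d)     ≡⟨ cong (embʷ g ∘ʷ_) embʷ-∘ʷ ⟩
    embʷ g ∘ʷ embʷ ((f ⊗₁ id) ∘ d)            ≡⟨ embʷ-∘ʷ ⟩
    embʷ (g ∘ ((f ⊗₁ id) ∘ d))                ∎)

module Below {o ℓ} (C : SymMonCat o ℓ) (u v : CentralIdem C) (u≤v : _≤ᶜ_ C u v) where
  open SymMonCat C
  open MonoidalProperties C
  open CentralIdem u renaming (u to u₀)
  open CentralIdem v using () renaming (U to V; u to v₀; central to v₀-central)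
  module Dᵘ = Discard u₀
  module Dᵛ = Discard v₀
  open ≡-Reasoning

  m : U ⇒ V
  m = proj₁ u≤v

  u₀≡v₀∘m : u₀ ≡ v₀ ∘ m
  u₀≡v₀∘m = proj₂ u≤v

  m∘discardᵛ : m ∘ Dᵛ.discard ≡ Dᵘ.discardˡ {V}
  m∘discardᵛ = begin
    m ∘ Dᵛ.discard                  ≡⟨ sym Dᵛ.discard-natural ⟩
    Dᵛ.discard ∘ (m ⊗₁ id)          ≡⟨ cong (_∘ (m ⊗₁ id)) v₀-central ⟩
    (λ⇒ ∘ (v₀ ⊗₁ id)) ∘ (m ⊗₁ id)   ≡⟨ pullʳ (sym ⊗id-∘) ⟩
    λ⇒ ∘ ((v₀ ∘ m) ⊗₁ id)           ≡⟨ cong (λ k → λ⇒ ∘ (k ⊗₁ id)) (sym u₀≡v₀∘m) ⟩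
    λ⇒ ∘ (u₀ ⊗₁ id)                 ∎

  discardᵛ-iso : IsIso (Dᵛ.discard {U})
  discardᵛ-iso = record
    { inverse = (id ⊗₁ m) ∘ inv
    ; isoˡ = split-epi-cancel (⊗id-inverse inv-isoʳ) (trans cancelled (sym identityˡ))
    ; isoʳ = begin
        Dᵛ.discard ∘ ((id ⊗₁ m) ∘ inv) ≡⟨ pullˡ (pullʳ (sym id⊗-∘)) ⟩
        (ρ⇒ ∘ (id ⊗₁ (v₀ ∘ m))) ∘ inv  ≡⟨ cong (λ k → (ρ⇒ ∘ (id ⊗₁ k)) ∘ inv) (sym u₀≡v₀∘m) ⟩
        (ρ⇒ ∘ (id ⊗₁ u₀)) ∘ inv        ≡⟨ inv-isoʳ ⟩
        id                             ∎
    }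
    where
    cancelled : (((id ⊗₁ m) ∘ inv) ∘ Dᵛ.discard) ∘ (Dᵘ.discard ⊗₁ id) ≡ Dᵘ.discard ⊗₁ id
    cancelled = begin
      (((id ⊗₁ m) ∘ inv) ∘ Dᵛ.discard) ∘ (Dᵘ.discard ⊗₁ id) ≡⟨ pullʳ Dᵛ.discard-natural ⟩
      ((id ⊗₁ m) ∘ inv) ∘ (Dᵘ.discard ∘ Dᵛ.discard)         ≡⟨ pullˡ (∘-cancelʳ inv-isoˡ) ⟩
      (id ⊗₁ m) ∘ Dᵛ.discard                                ≡⟨ cong ((id ⊗₁ m) ∘_) (sym Dᵛ.discard-α⇒) ⟩
      (id ⊗₁ m) ∘ ((id ⊗₁ Dᵛ.discard) ∘ α⇒)                 ≡⟨ pull-id⊗ ⟩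
      (id ⊗₁ (m ∘ Dᵛ.discard)) ∘ α⇒                         ≡⟨ cong (λ k → (id ⊗₁ k) ∘ α⇒) m∘discardᵛ ⟩
      (id ⊗₁ Dᵘ.discardˡ) ∘ α⇒                              ≡⟨ Dᵘ.discardˡ-α⇒ ⟩
      Dᵘ.discard ⊗₁ id                                      ∎

lemma4p2 : ∀ {o ℓ} (C : SymMonCat o ℓ) (u v : CentralIdem C) →
    _≤ᶜ_ C u v →
    CatIso (restrict C u) (coKleisli (tensorComonad C u v))
lemma4p2 C u v u≤v = record
  { F₀ = λ A → A
  ; F₁ = embʷ
  ; F-id = refl
  ; F-∘ = embʷ-coKleisli-∘
  ; F₀-bij = bijective _≡_
  ; F₁-bij = ∘-bijectiveʳ (Dᵛ.discard-iso-⊗ discardᵛ-iso)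
  }
  where
  open MonoidalProperties C
  open Restrict C v
  open Restriction C v
  open Below C u v u≤v
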